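{- Let $N\in\mathbb N$ and let $[N]^N_{\neq}$ be the set of permutations of $[N]=\{1,\dots,N\}$. For $r,s\in[N]$ let $\tau_{r,s}$ be the permutation with $\tau_{r,s}(\ell)=\ell$ for $\ell\notin\{r,s\}$, $\tau_{r,s}(r)=s$, $\tau_{r,s}(s)=r$ (so $\tau_{r,r}$ is the identity). Fix $r\in[N]$ and define $T_r=(T_{r,1},T_{r,2}):([N]^N_{\neq})^2\to([N]^N_{\neq})^2$ by $$T_{r,1}(j,k)=j\circ\tau_{r,(j^{ -1}\circ k)(r)},\qquad T_{r,2}(j,k)=k\circ\tau_{r,(k^{ -1}\circ j)(r)}.$$ Then $T_r\circ T_r$ is the identity map on $([N]^N_{\neq})^2$. In particular $T_r$ is bijective, and $T_{r,1}(j,k)(r)=k_r$, $T_{r,2}(j,k)(r)=j_r$ for all $(j,k)$.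
   Context: $\circ$ denotes composition of maps; for a permutation $j$, $j_r=j(r)$. -}

module Defs where

open import Data.Nat using (ℕ)
open import Data.Fin using (Fin)
open import Data.Product using (_×_; _,_)
open import Data.Fin.Permutation
  using (Permutation′; _⟨$⟩ʳ_; _⟨$⟩ˡ_; _∘ₚ_; transpose; flip)

-- Mathematical composition: (j ∘ᵐ k)(x) = j (k x).
-- (stdlib's _∘ₚ_ is diagrammatic: (π ∘ₚ ρ) ⟨$⟩ʳ x = ρ ⟨$⟩ʳ (π ⟨$⟩ʳ x).)
_∘ᵐ_ : ∀ {N} → Permutation′ N → Permutation′ N → Permutation′ N
j ∘ᵐ k = k ∘ₚ j

_⁻¹ : ∀ {N} → Permutation′ N → Permutation′ N
j ⁻¹ = flip j

τ : ∀ {N} → Fin N → Fin N → Permutation′ N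
τ r s = transpose r s

T₁ : ∀ {N} → Fin N → Permutation′ N → Permutation′ N → Permutation′ N
T₁ r j k = j ∘ᵐ τ r (((j ⁻¹) ∘ᵐ k) ⟨$⟩ʳ r)

T₂ : ∀ {N} → Fin N → Permutation′ N → Permutation′ N → Permutation′ N
T₂ r j k = k ∘ᵐ τ r (((k ⁻¹) ∘ᵐ j) ⟨$⟩ʳ r)

T : ∀ {N} → Fin N → Permutation′ N × Permutation′ N → Permutation′ N × Permutation′ N
T r (j , k) = T₁ r j k , T₂ r j k

-- Put s = j⁻¹(k r). Then T₁(j,k) = j ∘ τ_{r,s} sends r to j s = k r, and symmetrically T₂(j,k)
-- sends r to j r. Applying T₁ again therefore composes with τ_{r,s'} where
-- s' = (j ∘ τ_{r,s})⁻¹(j r) = τ_{r,s}(r) = s, and τ_{r,s} ∘ τ_{r,s} is the identity.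
module Submission where

open import Defs
open import Data.Nat using (ℕ)
open import Data.Fin using (Fin)
open import Data.Fin.Properties using (_≟_)
open import Data.Product using (_×_; _,_; proj₁; proj₂)
open import Data.Fin.Permutation
  using (Permutation; Permutation′; _⟨$⟩ʳ_; _⟨$⟩ˡ_; _≈_; _∘ₚ_; transpose; inverseʳ; inverseˡ)
import Data.Fin.Permutation.Components as PC
open import Relation.Nullary using (yes; no)
open import Relation.Nullary.Decidable using (dec-true; dec-false)
open import Relation.Binary.PropositionalEquality
  using (_≡_; refl; sym; trans; cong; subst; module ≡-Reasoning)

module _ {n : ℕ} where

  transpose-sendsˡ : (i j : Fin n) → PC.transpose i j i ≡ j
  transpose-sendsˡ i j rewrite dec-true (i ≟ i) refl = refl

  transpose-sendsʳ : (i j : Fin n) → PC.transpose i j j ≡ i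
  transpose-sendsʳ i j with j ≟ i
  ... | yes j≡i = j≡i
  ... | no  _   rewrite dec-true (j ≟ j) refl = refl

  transpose-comm : (i j k : Fin n) → PC.transpose i j k ≡ PC.transpose j i k
  transpose-comm i j k with k ≟ i | k ≟ j
  ... | yes k≡i | yes k≡j = trans (sym k≡j) k≡i
  ... | yes k≡i | no  _   rewrite dec-true (k ≟ i) k≡i = refl
  ... | no  _   | yes k≡j rewrite dec-true (k ≟ j) k≡j = refl
  ... | no  k≢i | no  k≢j rewrite dec-false (k ≟ i) k≢i | dec-false (k ≟ j) k≢j = refl

  transpose-involutive : (i j k : Fin n) → PC.transpose i j (PC.transpose i j k) ≡ k
  transpose-involutive i j k =
    trans (cong (PC.transpose i j) (transpose-comm i j k)) (PC.transpose-inverse i j)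

-- redirect r π y = π ∘ τ_{r, π⁻¹ y}: the permutation agreeing with π except that r ↦ y
-- (and π⁻¹ y ↦ π r). In this notation T₁ r j k = redirect r j (k r), T₂ r j k = redirect r k (j r).
redirect : ∀ {m n} → Fin m → Permutation m n → Fin n → Permutation m n
redirect r π y = transpose r (π ⟨$⟩ˡ y) ∘ₚ π

module _ {m n : ℕ} (r : Fin m) (π : Permutation m n) where

  redirect-sends : (y : Fin n) → redirect r π y ⟨$⟩ʳ r ≡ y
  redirect-sends y = trans (cong (π ⟨$⟩ʳ_) (transpose-sendsˡ r (π ⟨$⟩ˡ y))) (inverseʳ π)

  redirect-redirect : (y : Fin n) → redirect r (redirect r π y) (π ⟨$⟩ʳ r) ≈ π
  redirect-redirect y x = begin
    π ⟨$⟩ʳ PC.transpose r s (PC.transpose r s′ x) ≡⟨ cong (λ t → π ⟨$⟩ʳ PC.transpose r s (PC.transpose r t x)) s′≡s ⟩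
    π ⟨$⟩ʳ PC.transpose r s (PC.transpose r s x)  ≡⟨ cong (π ⟨$⟩ʳ_) (transpose-involutive r s x) ⟩
    π ⟨$⟩ʳ x                                      ∎
    where
    open ≡-Reasoning
    s s′ : Fin m
    s  = π ⟨$⟩ˡ y
    s′ = redirect r π y ⟨$⟩ˡ (π ⟨$⟩ʳ r)
    s′≡s : s′ ≡ s
    s′≡s = trans (cong (PC.transpose s r) (inverseˡ π)) (transpose-sendsʳ s r)

lemma3p1 : (N : ℕ) → (r : Fin N) →
    ((p : Permutation′ N × Permutation′ N) →
    (proj₁ (T r (T r p)) ≈ proj₁ p) × (proj₂ (T r (T r p)) ≈ proj₂ p))
    × ((j k : Permutation′ N) →
    (T₁ r j k ⟨$⟩ʳ r ≡ k ⟨$⟩ʳ r) × (T₂ r j k ⟨$⟩ʳ r ≡ j ⟨$⟩ʳ r))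
lemma3p1 N r = (λ { (j , k) → T₁-involution j k , T₁-involution k j }) , T-sends
  where
  T-sends : (j k : Permutation′ N) → (T₁ r j k ⟨$⟩ʳ r ≡ k ⟨$⟩ʳ r) × (T₂ r j k ⟨$⟩ʳ r ≡ j ⟨$⟩ʳ r)
  T-sends j k = redirect-sends r j (k ⟨$⟩ʳ r) , redirect-sends r k (j ⟨$⟩ʳ r)

  T₁-involution : (j k : Permutation′ N) → T₁ r (T₁ r j k) (T₂ r j k) ≈ j
  T₁-involution j k =
    subst (λ z → redirect r (T₁ r j k) z ≈ j)
          (sym (proj₂ (T-sends j k)))
          (redirect-redirect r j (k ⟨$⟩ʳ r))
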